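{- There is no sequence $(x_n)_{n=1}^\infty$ of pairwise distinct natural numbers and integer $t\in\mathbb{Z}$ such that $\mathbb{P}+t\supseteq\mathsf{FS}(\{x_n:n\in\mathbb{N}\})$.
   Context: $\mathbb{P}$ is the set of primes and $\mathbb{P}+t=\{p+t:p\in\mathbb{P}\}$. For $B\subset\mathbb{N}$, $\mathsf{FS}(B)=\{\sum_{n\in F}n: F\subset B,\ 0<|F|<\infty\}$. -}

module Defs where

open import Data.Nat using (ℕ; _+_)
open import Data.Integer using (ℤ; +_; _-_)
open import Data.List using (List; []; _∷_; map)
open import Data.Nat.ListAction using (sum)
open import Data.List.Relation.Unary.Unique.Propositional using (Unique)
open import Data.Nat.Primality using (Prime)
open import Data.Product using (∃; _×_)
open import Relation.Binary.PropositionalEquality using (_≡_)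

InShiftedPrimes : ℤ → ℤ → Set
InShiftedPrimes t z = ∃ λ p → Prime p × z ≡ (+ p) Data.Integer.+ t

-- A nonempty finite set F ⊂ ℕ of indices, given as a duplicate-free nonempty list
record FinIdx : Set where
  constructor finIdx
  field
    hd    : ℕ
    tl    : List ℕ
    uniq  : Unique (hd ∷ tl)

idxSum : (ℕ → ℕ) → FinIdx → ℕ
idxSum x (finIdx h t _) = sum (map x (h ∷ t))

FSInShiftedPrimes : (ℕ → ℕ) → ℤ → Set
FSInShiftedPrimes x t = (F : FinIdx) → InShiftedPrimes t (+ idxSum x F)

{-# OPTIONS --safe #-}
-- Write x₀ = p + t with p prime. Among the p + 1 prefix sums x₁ + ⋯ + xₖ (0 ≤ k ≤ p) two
-- agree modulo p, so some nonempty block B = xᵢ₊₁ + ⋯ + xⱼ is a positive multiple of p.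
-- Then x₀ + B = (p + B) + t, and p + B is a proper multiple of p, hence not prime.
module Submission where

open import Defs
open import Data.Nat using (ℕ; _≥_; zero; suc; _+_; _*_; _∸_; _≤_; _<_; _%_; NonZero)
open import Data.Nat.Properties
  using (≤-refl; ≤-trans; n≤1+n; n<1+n; <⇒≢; m≤m+n; m<m+n; +-assoc; +-suc; +-identityʳ; +-cancelˡ-≡; m+[n∸m]≡n)
open import Data.Nat.DivMod using (_/_; _mod_; m≡m%n+[m/n]*n)
open import Data.Nat.Divisibility using (_∣_; divides; ∣-refl; n∣m*n; ∣m+n∣m⇒∣n; ∣m∣n⇒∣m+n)
open import Data.Nat.Primality using (Prime; prime; Composite; composite; prime⇒nonZero)
open import Data.Nat.ListAction using (sum)
open import Data.Integer as ℤ using (ℤ; +_)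
import Data.Integer.Properties as ℤ
open import Algebra.Properties.AbelianGroup ℤ.+-0-abelianGroup using (∙-cancelʳ)
open import Data.Fin using (toℕ)
import Data.Fin.Properties as Fin
open import Data.List using (List; []; _∷_; map)
open import Data.List.Relation.Unary.All as All using (All; []; _∷_)
open import Data.List.Relation.Unary.AllPairs using ([]; _∷_)
open import Data.List.Relation.Unary.Unique.Propositional using (Unique)
open import Data.Product using (∃; ∃₂; _×_; _,_)
open import Relation.Nullary using (¬_)
open import Function.Definitions using (Injective)
open import Relation.Binary.PropositionalEquality using (_≡_; refl; sym; trans; cong; subst; module ≡-Reasoning)

open ≡-Reasoning

interval : ℕ → ℕ → List ℕ
interval a zero    = []
interval a (suc n) = a ∷ interval (suc a) n

interval-lowerBound : ∀ a n → All (a ≤_) (interval a n)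
interval-lowerBound a zero    = []
interval-lowerBound a (suc n) =
  ≤-refl ∷ All.map (≤-trans (n≤1+n a)) (interval-lowerBound (suc a) n)

interval-unique : ∀ a n → Unique (interval a n)
interval-unique a zero    = []
interval-unique a (suc n) =
  All.map <⇒≢ (interval-lowerBound (suc a) n) ∷ interval-unique (suc a) n

module _ (x : ℕ → ℕ) where

  blockSum : ℕ → ℕ → ℕ
  blockSum a n = sum (map x (interval a n))

  blockSum-+ : ∀ a m n → blockSum a (m + n) ≡ blockSum a m + blockSum (a + m) n
  blockSum-+ a zero    n rewrite +-identityʳ a = refl
  blockSum-+ a (suc m) n rewrite blockSum-+ (suc a) m n | +-suc a m =
    sym (+-assoc (x a) (blockSum (suc a) m) (blockSum (suc (a + m)) n))

  blockSum-positive : (∀ n → x n ≥ 1) → ∀ a n → blockSum a (suc n) ≥ 1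
  blockSum-positive x≥1 a n = ≤-trans (x≥1 a) (m≤m+n (x a) _)

%-pigeonhole : ∀ p .{{_ : NonZero p}} (f : ℕ → ℕ) → ∃₂ λ i j → i < j × f i % p ≡ f j % p
%-pigeonhole p f with i , j , i<j , fi≡fj ← Fin.pigeonhole (n<1+n p) (λ k → f (toℕ k) mod p) =
  toℕ i , toℕ j , i<j ,
  trans (sym (Fin.toℕ-fromℕ< _)) (trans (cong toℕ fi≡fj) (Fin.toℕ-fromℕ< _))

%-≡⇒∣ : ∀ p .{{_ : NonZero p}} m n → m % p ≡ (m + n) % p → p ∣ n
%-≡⇒∣ p m n same-remainder = ∣m+n∣m⇒∣n (divides ((m + n) / p) quotients) (n∣m*n (m / p))
  where
  quotients : m / p * p + n ≡ (m + n) / p * p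
  quotients = +-cancelˡ-≡ (m % p) _ _ (begin
    m % p + (m / p * p + n)        ≡⟨ sym (+-assoc (m % p) _ n) ⟩
    m % p + m / p * p + n          ≡⟨ cong (_+ n) (sym (m≡m%n+[m/n]*n m p)) ⟩
    m + n                          ≡⟨ m≡m%n+[m/n]*n (m + n) p ⟩
    (m + n) % p + (m + n) / p * p  ≡⟨ cong (_+ (m + n) / p * p) (sym same-remainder) ⟩
    m % p + (m + n) / p * p        ∎)

divisibleBlock : ∀ (x : ℕ → ℕ) p .{{_ : NonZero p}} a →
                 ∃₂ λ b n → a ≤ b × p ∣ blockSum x b (suc n)
divisibleBlock x p a with i , j , i<j , prefixes≡ ← %-pigeonhole p (blockSum x a) =
  a + i , d , m≤m+n a i , %-≡⇒∣ p (blockSum x a i) _ (trans prefixes≡ (cong (_% p) prefix-j))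
  where
  d = j ∸ suc i
  prefix-j : blockSum x a j ≡ blockSum x a i + blockSum x (a + i) (suc d)
  prefix-j = trans (cong (blockSum x a) (trans (sym (m+[n∸m]≡n i<j)) (sym (+-suc i d))))
                   (blockSum-+ x a i (suc d))

zeroAndInterval : ∀ b n → 1 ≤ b → FinIdx
zeroAndInterval b n 1≤b =
  finIdx 0 (interval b n)
    (All.map (λ b≤i → <⇒≢ (≤-trans 1≤b b≤i)) (interval-lowerBound b n) ∷ interval-unique b n)

shiftedPrime-+ : ∀ {m k q} p t → + m ≡ + p ℤ.+ t → + (m + k) ≡ + q ℤ.+ t → q ≡ p + k
shiftedPrime-+ {m} {k} {q} p t m≡p+t m+k≡q+t =
  ℤ.+-injective (∙-cancelʳ t (+ q) (+ (p + k)) (begin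
    + q ℤ.+ t                ≡⟨ sym m+k≡q+t ⟩
    + (m + k)                ≡⟨ ℤ.pos-+ m k ⟩
    + m ℤ.+ + k              ≡⟨ cong (ℤ._+ + k) m≡p+t ⟩
    + p ℤ.+ t ℤ.+ + k        ≡⟨ ℤ.+-assoc (+ p) t (+ k) ⟩
    + p ℤ.+ (t ℤ.+ + k)      ≡⟨ cong (ℤ._+_ (+ p)) (ℤ.+-comm t (+ k)) ⟩
    + p ℤ.+ (+ k ℤ.+ t)      ≡⟨ sym (ℤ.+-assoc (+ p) (+ k) t) ⟩
    + p ℤ.+ + k ℤ.+ t        ≡⟨ cong (ℤ._+ t) (sym (ℤ.pos-+ p k)) ⟩
    + (p + k) ℤ.+ t          ∎))

prime+multiple-composite : ∀ {p k} → Prime p → p ∣ k → k ≥ 1 → Composite (p + k)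
prime+multiple-composite {p} (prime _) p∣k k≥1 = composite (m<m+n p k≥1) (∣m∣n⇒∣m+n ∣-refl p∣k)

proposition4p2 : ¬ (∃ λ (x : ℕ → ℕ) → ∃ λ (t : ℤ) →
    ((n : ℕ) → x n ≥ 1) × Injective _≡_ _≡_ x × FSInShiftedPrimes x t)
proposition4p2 (x , t , x≥1 , _ , fs)
  with p , p-prime , x₀≡p+t ← fs (finIdx 0 [] ([] ∷ []))
  with b , n , 1≤b , p∣B ← divisibleBlock x p {{prime⇒nonZero p-prime}} 1
  with q , prime q-notComposite , x₀+B≡q+t ← fs (zeroAndInterval b (suc n) 1≤b) =
  q-notComposite (subst Composite (sym q≡p+B)
    (prime+multiple-composite p-prime p∣B (blockSum-positive x x≥1 b n)))
  where
  q≡p+B : q ≡ p + blockSum x b (suc n)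
  q≡p+B = shiftedPrime-+ p t (trans (cong +_ (sym (+-identityʳ (x 0)))) x₀≡p+t) x₀+B≡q+t
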